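{- Every elementary existential doctrine $(\mathbb{C},P)$ with singletons admits sheafification, i.e. the full subcategory $\mathbf{Shv}(\mathbb{C},P)$ of $\mathbb{C}$ on the $P$-sheaves is reflective in $\mathbb{C}$ (the inclusion has a left adjoint).
   Context: A doctrine is a pair $(\mathbb{C},P)$ with $\mathbb{C}$ a category with finite products and $P:\mathbb{C}^{op}\to\mathbf{ISL}$ a functor into inf-semilattices; write $f^*=P(f)$, $\wedge$ for meets, $\top_A$ for the top of $P(A)$. It is elementary existential if each $f^*$ has a left adjoint $\exists_f$ satisfying Beck–Chevalley for pullbacks and Frobenius reciprocity $\exists_f(\alpha\wedge f^*\beta)=\exists_f\alpha\wedge\beta$. Equality on $A$: $\delta_A=\exists_{\Delta_A}\top_A\in P(A\times A)$. A comprehension of $\alpha\in P(A)$ is a morphism $\lfloor\alpha\rfloor:X\to A$ with $\top_X\le\lfloor\alpha\rfloor^*\alpha$ such that every $f:Y\to A$ with $\top_Y\le f^*\alpha$ factors uniquely through it; $f:X\to Y$ has an image if $\exists_f\top_X$ has a comprehension. Power objects: for each $X$ an object $\mathbb{P}(X)$ and $\in_X\in P(X\times\mathbb{P}(X))$ such that for each $\gamma\in P(X\times Y)$ there is a unique $\{\gamma\}:Y\to\mathbb{P}(X)$ with $\gamma=(\mathrm{id}_X\times\{\gamma\})^*\in_X$. A formula $F\in P(Y\times A)$ is a functional relation from $Y$ to $A$ if $F(y,a)\wedge F(y,a')\le\delta_A(a,a')$ and $\exists a{:}A.\,F(y,a)=\top_Y$ (internal-language notation). A morphism $f:A\to B$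 is internally injective if $\delta_A=(f\times f)^*\delta_B$, internally surjective if $\exists_f\top_A=\top_B$, internally bijective if both. The doctrine has singletons if (i) it has power objects; (ii) for every $A$ the morphism $\{\delta_A\}:A\to\mathbb{P}(A)$ has an image and is internally injective; (iii) for every $g:Y\to\mathbb{P}(A)$, the formula $(\mathrm{id}_A\times g)^*\in_A$, read as a relation from $Y$ to $A$, is functional from $Y$ to $A$ iff $g^*(\exists_{\{\delta_A\}}\top_A)=\top_Y$. An object $A$ is a $P$-sheaf if for every span $Y\xleftarrow{d}X\xrightarrow{q}A$ with $d$ internally bijective there is a unique $h:Y\to A$ with $h\circ d=q$. -}

module Defs where

open import Level using (Level; _⊔_; suc)
open import Relation.Binary.PropositionalEquality using (_≡_)
open import Relation.Binary.Lattice.Bundles using (BoundedMeetSemilattice)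
open import Data.Product using (Σ; _,_; _×_)
open import Function.Bundles using (_⇔_)

record Category (o h : Level) : Set (suc (o ⊔ h)) where
  infixr 9 _∘_
  infix  4 _⇒_
  field
    Obj       : Set o
    _⇒_       : Obj → Obj → Set h
    id        : ∀ {A} → A ⇒ A
    _∘_       : ∀ {A B C} → B ⇒ C → A ⇒ B → A ⇒ C
    identityˡ : ∀ {A B} {f : A ⇒ B} → id ∘ f ≡ f
    identityʳ : ∀ {A B} {f : A ⇒ B} → f ∘ id ≡ f
    assoc     : ∀ {A B C D} {f : A ⇒ B} {g : B ⇒ C} {k : C ⇒ D} →
                (k ∘ g) ∘ f ≡ k ∘ (g ∘ f)

  IsPullback : ∀ {A B C D} → A ⇒ C → B ⇒ C → D ⇒ A → D ⇒ B → Set (o ⊔ h)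
  IsPullback {A} {B} {C} {D} f g p q =
    (f ∘ p ≡ g ∘ q) ×
    (∀ {X} (u : X ⇒ A) (v : X ⇒ B) → f ∘ u ≡ g ∘ v →
       Σ (X ⇒ D) λ w → (p ∘ w ≡ u) × (q ∘ w ≡ v) ×
         (∀ (w' : X ⇒ D) → p ∘ w' ≡ u → q ∘ w' ≡ v → w' ≡ w))

record FiniteProducts {o h} (C : Category o h) : Set (o ⊔ h) where
  open Category C
  infixr 7 _⊗_ _⊗₁_
  field
    𝟙        : Obj
    !        : ∀ {A} → A ⇒ 𝟙
    !-unique : ∀ {A} (f : A ⇒ 𝟙) → f ≡ !
    _⊗_      : Obj → Obj → Obj
    π₁       : ∀ {A B} → A ⊗ B ⇒ A
    π₂       : ∀ {A B} → A ⊗ B ⇒ B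
    ⟨_,_⟩    : ∀ {X A B} → X ⇒ A → X ⇒ B → X ⇒ A ⊗ B
    π₁∘⟨⟩    : ∀ {X A B} {f : X ⇒ A} {g : X ⇒ B} → π₁ ∘ ⟨ f , g ⟩ ≡ f
    π₂∘⟨⟩    : ∀ {X A B} {f : X ⇒ A} {g : X ⇒ B} → π₂ ∘ ⟨ f , g ⟩ ≡ g
    ⟨⟩-unique : ∀ {X A B} {f : X ⇒ A} {g : X ⇒ B} (u : X ⇒ A ⊗ B) →
                π₁ ∘ u ≡ f → π₂ ∘ u ≡ g → u ≡ ⟨ f , g ⟩

  _⊗₁_ : ∀ {A B C D} → A ⇒ B → C ⇒ D → A ⊗ C ⇒ B ⊗ D
  f ⊗₁ g = ⟨ f ∘ π₁ , g ∘ π₂ ⟩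

  Δ : ∀ {A} → A ⇒ A ⊗ A
  Δ = ⟨ id , id ⟩

  swap : ∀ {A B} → A ⊗ B ⇒ B ⊗ A
  swap = ⟨ π₂ , π₁ ⟩

record Doctrine {o h} (C : Category o h) (FP : FiniteProducts C)
                (c ℓ₁ ℓ₂ : Level) : Set (o ⊔ h ⊔ suc (c ⊔ ℓ₁ ⊔ ℓ₂)) where
  open Category C
  field
    P : Obj → BoundedMeetSemilattice c ℓ₁ ℓ₂

  Form : Obj → Set c
  Form A = BoundedMeetSemilattice.Carrier (P A)

  Le : (A : Obj) → Form A → Form A → Set ℓ₂
  Le A = BoundedMeetSemilattice._≤_ (P A)

  Eq : (A : Obj) → Form A → Form A → Set ℓ₁
  Eq A = BoundedMeetSemilattice._≈_ (P A)

  Meet : (A : Obj) → Form A → Form A → Form A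
  Meet A = BoundedMeetSemilattice._∧_ (P A)

  Top : (A : Obj) → Form A
  Top A = BoundedMeetSemilattice.⊤ (P A)

  field
    reindex    : ∀ {A B} → A ⇒ B → Form B → Form A
    reindex-mono : ∀ {A B} (f : A ⇒ B) {x y : Form B} →
                   Le B x y → Le A (reindex f x) (reindex f y)
    reindex-∧  : ∀ {A B} (f : A ⇒ B) (x y : Form B) →
                 Eq A (reindex f (Meet B x y)) (Meet A (reindex f x) (reindex f y))
    reindex-⊤  : ∀ {A B} (f : A ⇒ B) → Eq A (reindex f (Top B)) (Top A)
    reindex-id : ∀ {A} (x : Form A) → Eq A (reindex id x) x
    reindex-∘  : ∀ {A B C} (f : A ⇒ B) (g : B ⇒ C) (x : Form C) →
                 Eq A (reindex (g ∘ f) x) (reindex f (reindex g x))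

record ElementaryExistential {o h} {C : Category o h} {FP : FiniteProducts C}
         {c ℓ₁ ℓ₂} (D : Doctrine C FP c ℓ₁ ℓ₂) : Set (o ⊔ h ⊔ c ⊔ ℓ₁ ⊔ ℓ₂) where
  open Category C
  open Doctrine D
  field
    ∃f     : ∀ {A B} → A ⇒ B → Form A → Form B
    ∃-adj  : ∀ {A B} (f : A ⇒ B) (α : Form A) (β : Form B) →
             Le B (∃f f α) β ⇔ Le A α (reindex f β)
    beck-chevalley : ∀ {A B C' D'} {f : A ⇒ C'} {g : B ⇒ C'} {p : D' ⇒ A} {q : D' ⇒ B} →
             IsPullback f g p q → ∀ (α : Form A) →
             Eq B (reindex g (∃f f α)) (∃f q (reindex p α))
    frobenius : ∀ {A B} (f : A ⇒ B) (α : Form A) (β : Form B) →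
             Eq B (∃f f (Meet A α (reindex f β))) (Meet B (∃f f α) β)

module Notions {o h} {C : Category o h} {FP : FiniteProducts C}
         {c ℓ₁ ℓ₂} {D : Doctrine C FP c ℓ₁ ℓ₂} (E : ElementaryExistential D) where
  open Category C
  open FiniteProducts FP
  open Doctrine D
  open ElementaryExistential E

  δ : (A : Obj) → Form (A ⊗ A)
  δ A = ∃f Δ (Top A)

  IsComprehension : ∀ {A X} → Form A → X ⇒ A → Set (o ⊔ h ⊔ ℓ₂)
  IsComprehension {A} {X} α k =
    Le X (Top X) (reindex k α) ×
    (∀ {Y} (f : Y ⇒ A) → Le Y (Top Y) (reindex f α) →
       Σ (Y ⇒ X) λ g → (k ∘ g ≡ f) × (∀ (g' : Y ⇒ X) → k ∘ g' ≡ f → g' ≡ g))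

  HasComprehension : ∀ {A} → Form A → Set (o ⊔ h ⊔ ℓ₂)
  HasComprehension {A} α = Σ Obj λ X → Σ (X ⇒ A) λ k → IsComprehension α k

  HasImage : ∀ {X Y} → X ⇒ Y → Set (o ⊔ h ⊔ ℓ₂)
  HasImage {X} f = HasComprehension (∃f f (Top X))

  InternallyInjective : ∀ {A B} → A ⇒ B → Set ℓ₁
  InternallyInjective {A} {B} f = Eq (A ⊗ A) (δ A) (reindex (f ⊗₁ f) (δ B))

  InternallySurjective : ∀ {A B} → A ⇒ B → Set ℓ₁
  InternallySurjective {A} {B} f = Eq B (∃f f (Top A)) (Top B)

  InternallyBijective : ∀ {A B} → A ⇒ B → Set ℓ₁
  InternallyBijective f = InternallyInjective f × InternallySurjective f

  -- F ∈ P(Y × A) is a functional relation from Y to A: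
  --   F(y,a) ∧ F(y,a') ≤ δ_A(a,a')   in context Y × (A × A)
  --   ∃a:A. F(y,a) = ⊤_Y
  IsFunctional : (Y A : Obj) → Form (Y ⊗ A) → Set (ℓ₁ ⊔ ℓ₂)
  IsFunctional Y A F =
    Le (Y ⊗ (A ⊗ A))
       (Meet (Y ⊗ (A ⊗ A)) (reindex ⟨ π₁ , π₁ ∘ π₂ ⟩ F) (reindex ⟨ π₁ , π₂ ∘ π₂ ⟩ F))
       (reindex π₂ (δ A))
    × Eq Y (∃f π₁ F) (Top Y)

  record PowerObjects : Set (o ⊔ h ⊔ c ⊔ ℓ₁) where
    field
      𝒫     : Obj → Obj
      ∈     : (X : Obj) → Form (X ⊗ 𝒫 X)
      name  : (X Y : Obj) → Form (X ⊗ Y) → Y ⇒ 𝒫 X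
      name-spec   : ∀ X Y (γ : Form (X ⊗ Y)) →
                    Eq (X ⊗ Y) γ (reindex (id ⊗₁ name X Y γ) (∈ X))
      name-unique : ∀ X Y (γ : Form (X ⊗ Y)) (g : Y ⇒ 𝒫 X) →
                    Eq (X ⊗ Y) γ (reindex (id ⊗₁ g) (∈ X)) → g ≡ name X Y γ

  record HasSingletons : Set (o ⊔ h ⊔ c ⊔ ℓ₁ ⊔ ℓ₂) where
    field
      power : PowerObjects
    open PowerObjects power
    sgl : (A : Obj) → A ⇒ 𝒫 A
    sgl A = name A A (δ A)
    field
      sgl-image     : ∀ A → HasImage (sgl A)
      sgl-injective : ∀ A → InternallyInjective (sgl A)
      sgl-functional : ∀ {Y A} (g : Y ⇒ 𝒫 A) →
        IsFunctional Y A (reindex swap (reindex (id ⊗₁ g) (∈ A)))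
        ⇔ Eq Y (reindex g (∃f (sgl A) (Top A))) (Top Y)

  IsSheaf : Obj → Set (o ⊔ h ⊔ ℓ₁)
  IsSheaf A = ∀ {X Y} (d : X ⇒ Y) (q : X ⇒ A) → InternallyBijective d →
    Σ (Y ⇒ A) λ k → (k ∘ d ≡ q) × (∀ (k' : Y ⇒ A) → k' ∘ d ≡ q → k' ≡ k)

  AdmitsSheafification : Set (o ⊔ h ⊔ ℓ₁)
  AdmitsSheafification =
    ∀ (A : Obj) → Σ Obj λ S → IsSheaf S × Σ (A ⇒ S) λ η →
      ∀ (B : Obj) → IsSheaf B → ∀ (f : A ⇒ B) →
        Σ (S ⇒ B) λ f̄ → (f̄ ∘ η ≡ f) × (∀ (g : S ⇒ B) → g ∘ η ≡ f → g ≡ f̄)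

module Submission where

-- For an object A let k : S → 𝒫A be the comprehension of the image
-- ∃_{sgl} ⊤ of the singleton map sgl = {δ_A} : A → 𝒫A, and η : A → S the
-- corestriction of sgl.  Then η is the sheafification of A:
--
--  * 𝒫A is a sheaf: n : X → 𝒫A extends along an internally bijective
--    d : X → Y to the name of the relation ∃_{id×d}(members of n).  This rests
--    on the kernel formula  (id×f)* ∃_{id×f} φ (a,u) = ∃u'. f u' = f u ∧ φ(a,u'),
--    obtained by Beck–Chevalley for the graph of f, which shows that
--    (id×d)* ∃_{id×d} is the identity when d is internally injective;
--  * a comprehension of a formula on a sheaf is again a sheaf, so S is one;
--  * η is internally surjective (it is the corestriction of sgl to its image)
--    and internally injective (because sgl = k ∘ η is);
--  * an internally bijective map into a sheaf is a reflection, directly by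
--    the definition of a sheaf.

open import Defs
open import Level using (_⊔_)
open import Data.Product using (Σ; _,_; _×_; proj₁; proj₂)
open import Function.Bundles using (Equivalence)
open import Relation.Binary.PropositionalEquality as ≡ using (_≡_; refl; cong; cong₂)
open import Relation.Binary.Lattice.Bundles using (BoundedMeetSemilattice)
import Relation.Binary.Lattice.Properties.MeetSemilattice as MeetProperties
import Relation.Binary.Lattice.Properties.BoundedMeetSemilattice as BoundedMeetProperties
import Relation.Binary.Reasoning.PartialOrder as PosetReasoning

module Sheafification {o h c ℓ₁ ℓ₂} {C : Category o h} {FP : FiniteProducts C}
    {D : Doctrine C FP c ℓ₁ ℓ₂} (E : ElementaryExistential D) where
  open Category C
  open FiniteProducts FP
  open Doctrine D
  open ElementaryExistential E
  open Notions E

  ∘-extend : ∀ {X Y Z W} {p : Z ⇒ W} {u : Y ⇒ Z} {a : Y ⇒ W} (k : X ⇒ Y) →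
             p ∘ u ≡ a → p ∘ (u ∘ k) ≡ a ∘ k
  ∘-extend k e = ≡.trans (≡.sym assoc) (cong (_∘ k) e)

  ⟨⟩-ext : ∀ {X A B} {u v : X ⇒ A ⊗ B} → π₁ ∘ u ≡ π₁ ∘ v → π₂ ∘ u ≡ π₂ ∘ v → u ≡ v
  ⟨⟩-ext {v = v} p q = ≡.trans (⟨⟩-unique _ p q) (≡.sym (⟨⟩-unique v refl refl))

  ⟨⟩∘ : ∀ {X Y A B} {f : Y ⇒ A} {g : Y ⇒ B} (k : X ⇒ Y) →
        ⟨ f , g ⟩ ∘ k ≡ ⟨ f ∘ k , g ∘ k ⟩
  ⟨⟩∘ k = ⟨⟩-unique _ (∘-extend k π₁∘⟨⟩) (∘-extend k π₂∘⟨⟩)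

  ⊗₁∘⟨⟩ : ∀ {X A B A' B'} {f : A ⇒ A'} {g : B ⇒ B'} {a : X ⇒ A} {b : X ⇒ B} →
          (f ⊗₁ g) ∘ ⟨ a , b ⟩ ≡ ⟨ f ∘ a , g ∘ b ⟩
  ⊗₁∘⟨⟩ {f = f} {g} {a} {b} = ≡.trans (⟨⟩∘ ⟨ a , b ⟩)
    (cong₂ ⟨_,_⟩ (≡.trans assoc (cong (f ∘_) π₁∘⟨⟩)) (≡.trans assoc (cong (g ∘_) π₂∘⟨⟩)))

  ⊗₁∘⊗₁ : ∀ {A B A' B' A'' B''} {f : A' ⇒ A''} {g : B' ⇒ B''} {f' : A ⇒ A'} {g' : B ⇒ B'} →
          (f ⊗₁ g) ∘ (f' ⊗₁ g') ≡ (f ∘ f') ⊗₁ (g ∘ g')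
  ⊗₁∘⊗₁ = ≡.trans ⊗₁∘⟨⟩ (cong₂ ⟨_,_⟩ (≡.sym assoc) (≡.sym assoc))

  id⊗₁∘id⊗₁ : ∀ {A X Y Z} {g : Y ⇒ Z} {d : X ⇒ Y} →
              (id {A} ⊗₁ g) ∘ (id ⊗₁ d) ≡ id ⊗₁ (g ∘ d)
  id⊗₁∘id⊗₁ = ≡.trans ⊗₁∘⊗₁ (cong (_⊗₁ _) identityˡ)

  id⊗₁id : ∀ {A B} → id {A} ⊗₁ id {B} ≡ id
  id⊗₁id = ⟨⟩-ext (≡.trans π₁∘⟨⟩ (≡.trans identityˡ (≡.sym identityʳ)))
                  (≡.trans π₂∘⟨⟩ (≡.trans identityˡ (≡.sym identityʳ)))

  ⊗₁∘Δ : ∀ {X Y} (f : X ⇒ Y) → (f ⊗₁ f) ∘ Δ ≡ Δ ∘ f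
  ⊗₁∘Δ f = ≡.trans ⊗₁∘⟨⟩ (≡.trans (cong₂ ⟨_,_⟩ identityʳ identityʳ)
             (≡.sym (≡.trans (⟨⟩∘ f) (cong₂ ⟨_,_⟩ identityˡ identityˡ))))

  π₁∘id⊗₁ : ∀ {A X Y} {g : X ⇒ Y} → π₁ ∘ (id {A} ⊗₁ g) ≡ π₁
  π₁∘id⊗₁ = ≡.trans π₁∘⟨⟩ identityˡ

  π₂∘⊗₁id : ∀ {X Y B} {g : X ⇒ Y} → π₂ ∘ (g ⊗₁ id {B}) ≡ π₂
  π₂∘⊗₁id = ≡.trans π₂∘⟨⟩ identityˡ

  ⟨π₁,π₂⟩ : ∀ {A B} → ⟨ π₁ , π₂ ⟩ ≡ id {A ⊗ B}
  ⟨π₁,π₂⟩ = ≡.sym (⟨⟩-unique id identityʳ identityʳ)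

  product-pullbackʳ : ∀ {A X Y} (d : X ⇒ Y) → IsPullback d (π₂ {A} {Y}) π₂ (id ⊗₁ d)
  product-pullbackʳ d = ≡.sym π₂∘⟨⟩ , λ a v sq →
    ⟨ π₁ ∘ v , a ⟩ , π₂∘⟨⟩ ,
    ≡.trans ⊗₁∘⟨⟩ (≡.sym (⟨⟩-unique v (≡.sym identityˡ) (≡.sym sq))) ,
    λ w' p q → ⟨⟩-unique w' (≡.trans (≡.sym (∘-extend w' π₁∘id⊗₁)) (cong (π₁ ∘_) q)) p

  product-pullbackˡ : ∀ {B B' Z} (g : B ⇒ B') → IsPullback (π₁ {B'} {Z}) g (g ⊗₁ id) π₁
  product-pullbackˡ g = π₁∘⟨⟩ , λ a v sq →
    ⟨ v , π₂ ∘ a ⟩ ,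
    ≡.trans ⊗₁∘⟨⟩ (≡.sym (⟨⟩-unique a sq (≡.sym identityˡ))) , π₁∘⟨⟩ ,
    λ w' p q → ⟨⟩-unique w' q (≡.trans (≡.sym (∘-extend w' π₂∘⊗₁id)) (cong (π₂ ∘_) p))

  mono-kernel-pair : ∀ {S B} (k : S ⇒ B) →
                     (∀ {Y} {g g' : Y ⇒ S} → k ∘ g ≡ k ∘ g' → g ≡ g') → IsPullback k k id id
  mono-kernel-pair k mono = refl , λ a b sq → a , identityˡ , ≡.trans identityˡ (mono sq) ,
    λ w' p _ → ≡.trans (≡.sym identityˡ) p

  module Lat {A : Obj} = BoundedMeetSemilattice (P A)
  module MeetLaws {A : Obj} = MeetProperties (BoundedMeetSemilattice.meetSemilattice (P A))
  module TopLaws {A : Obj} = BoundedMeetProperties (P A)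
  module Reasoning (A : Obj) = PosetReasoning (BoundedMeetSemilattice.poset (P A))

  reindex-cong : ∀ {A B} (f : A ⇒ B) {x y : Form B} → Eq B x y →
                 Eq A (reindex f x) (reindex f y)
  reindex-cong f e = Lat.antisym (reindex-mono f (Lat.reflexive e))
                                 (reindex-mono f (Lat.reflexive (Lat.Eq.sym e)))

  reindex-≡ : ∀ {A B} {f g : A ⇒ B} (x : Form B) → f ≡ g → Eq A (reindex f x) (reindex g x)
  reindex-≡ x refl = Lat.Eq.refl

  ∃-universal : ∀ {A B} (f : A ⇒ B) {α β} → Le A α (reindex f β) → Le B (∃f f α) β
  ∃-universal f {α} {β} = Equivalence.from (∃-adj f α β)

  ∃-unit : ∀ {A B} (f : A ⇒ B) (α : Form A) → Le A α (reindex f (∃f f α))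
  ∃-unit f α = Equivalence.to (∃-adj f α (∃f f α)) Lat.refl

  ∃-mono : ∀ {A B} (f : A ⇒ B) {α α'} → Le A α α' → Le B (∃f f α) (∃f f α')
  ∃-mono f {α' = α'} p = ∃-universal f (Lat.trans p (∃-unit f α'))

  ∃-cong : ∀ {A B} (f : A ⇒ B) {α α'} → Eq A α α' → Eq B (∃f f α) (∃f f α')
  ∃-cong f e = Lat.antisym (∃-mono f (Lat.reflexive e)) (∃-mono f (Lat.reflexive (Lat.Eq.sym e)))

  ∃-≡ : ∀ {A B} {f g : A ⇒ B} (α : Form A) → f ≡ g → Eq B (∃f f α) (∃f g α)
  ∃-≡ α refl = Lat.Eq.refl

  -- left adjoints compose: ∃_{g∘f} = ∃_g ∘ ∃_f
  ∃-∘ : ∀ {A B Z} (f : A ⇒ B) (g : B ⇒ Z) (α : Form A) →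
        Eq Z (∃f (g ∘ f) α) (∃f g (∃f f α))
  ∃-∘ f g α = Lat.antisym
    (∃-universal (g ∘ f) (Lat.trans (∃-unit f α)
      (Lat.trans (reindex-mono f (∃-unit g (∃f f α)))
                 (Lat.reflexive (Lat.Eq.sym (reindex-∘ f g _))))))
    (∃-universal g (∃-universal f
      (Lat.trans (∃-unit (g ∘ f) α) (Lat.reflexive (reindex-∘ f g _)))))

  ∃-id : ∀ {A} (α : Form A) → Eq A (∃f id α) α
  ∃-id α = Lat.antisym (∃-universal id (Lat.reflexive (Lat.Eq.sym (reindex-id α))))
                       (Lat.trans (∃-unit id α) (Lat.reflexive (reindex-id _)))

  ∃-reindex-surjective : ∀ {A B} (e : A ⇒ B) → InternallySurjective e →
                         ∀ β → Eq B (∃f e (reindex e β)) β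
  ∃-reindex-surjective {A} {B} e surj β = begin-equality
    ∃f e (reindex e β)                   ≈⟨ ∃-cong e (TopLaws.identityˡ _) ⟨
    ∃f e (Meet A (Top A) (reindex e β))  ≈⟨ frobenius e (Top A) β ⟩
    Meet B (∃f e (Top A)) β              ≈⟨ MeetLaws.∧-cong surj Lat.Eq.refl ⟩
    Meet B (Top B) β                     ≈⟨ TopLaws.identityˡ β ⟩
    β                                    ∎
    where open Reasoning B

  δ-preserved : ∀ {X Y} (f : X ⇒ Y) → Le (X ⊗ X) (δ X) (reindex (f ⊗₁ f) (δ Y))
  δ-preserved {X} {Y} f = ∃-universal Δ (begin
    Top X                               ≈⟨ reindex-⊤ f ⟨
    reindex f (Top Y)                   ≤⟨ reindex-mono f (∃-unit Δ (Top Y)) ⟩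
    reindex f (reindex Δ (δ Y))         ≈⟨ reindex-∘ f Δ _ ⟨
    reindex (Δ ∘ f) (δ Y)               ≈⟨ reindex-≡ _ (⊗₁∘Δ f) ⟨
    reindex ((f ⊗₁ f) ∘ Δ) (δ Y)        ≈⟨ reindex-∘ Δ (f ⊗₁ f) _ ⟩
    reindex Δ (reindex (f ⊗₁ f) (δ Y))  ∎)
    where open Reasoning X

  injective-cancel : ∀ {A S B} (e : A ⇒ S) (k : S ⇒ B) →
                     InternallyInjective (k ∘ e) → InternallyInjective e
  injective-cancel {A} {S} {B} e k inj = Lat.antisym (δ-preserved e) (begin
    reindex (e ⊗₁ e) (δ S)                      ≤⟨ reindex-mono (e ⊗₁ e) (δ-preserved k) ⟩
    reindex (e ⊗₁ e) (reindex (k ⊗₁ k) (δ B))   ≈⟨ reindex-∘ (e ⊗₁ e) (k ⊗₁ k) _ ⟨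
    reindex ((k ⊗₁ k) ∘ (e ⊗₁ e)) (δ B)         ≈⟨ reindex-≡ _ ⊗₁∘⊗₁ ⟩
    reindex ((k ∘ e) ⊗₁ (k ∘ e)) (δ B)          ≈⟨ inj ⟨
    δ A                                         ∎)
    where open Reasoning (A ⊗ A)

  reindex-retract : ∀ {A B} (s : A ⇒ B) (r : B ⇒ A) → r ∘ s ≡ id →
                    ∀ φ → Eq A (reindex s (reindex r φ)) φ
  reindex-retract s r r∘s φ =
    Lat.Eq.trans (Lat.Eq.sym (reindex-∘ s r φ)) (Lat.Eq.trans (reindex-≡ φ r∘s) (reindex-id φ))

  id⊗₁-surjective : ∀ {A X Y} (d : X ⇒ Y) → InternallySurjective d →
                    InternallySurjective (id {A} ⊗₁ d)
  id⊗₁-surjective {A} {X} {Y} d surj = begin-equality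
    ∃f (id ⊗₁ d) (Top (A ⊗ X))             ≈⟨ ∃-cong (id ⊗₁ d) (reindex-⊤ π₂) ⟨
    ∃f (id ⊗₁ d) (reindex π₂ (Top X))      ≈⟨ beck-chevalley (product-pullbackʳ d) (Top X) ⟨
    reindex π₂ (∃f d (Top X))              ≈⟨ reindex-cong π₂ surj ⟩
    reindex π₂ (Top Y)                     ≈⟨ reindex-⊤ π₂ ⟩
    Top (A ⊗ Y)                            ∎
    where open Reasoning (A ⊗ Y)

  -- The kernel formula for  (id_A × f)* ∃_{id_A × f}

  module Graph {A U V : Obj} (f : U ⇒ V) where
    γ : A ⊗ U ⇒ (A ⊗ V) ⊗ U
    γ = ⟨ id ⊗₁ f , π₂ ⟩

    -- e((a,v),u) = (f u, v): the graph is where e meets the diagonal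
    e : (A ⊗ V) ⊗ U ⇒ V ⊗ V
    e = ⟨ f ∘ π₂ , π₂ ∘ π₁ ⟩

    u : (A ⊗ V) ⊗ U ⇒ A ⊗ U
    u = ⟨ π₁ ∘ π₁ , π₂ ⟩

    u∘γ : u ∘ γ ≡ id
    u∘γ = ≡.trans (⟨⟩∘ γ) (≡.trans (cong₂ ⟨_,_⟩ first π₂∘⟨⟩) ⟨π₁,π₂⟩)
      where
      first : (π₁ ∘ π₁) ∘ γ ≡ π₁
      first = ≡.trans assoc (≡.trans (cong (π₁ ∘_) π₁∘⟨⟩) π₁∘id⊗₁)

    π₁∘u∘ : ∀ {X} (v : X ⇒ (A ⊗ V) ⊗ U) → π₁ ∘ (u ∘ v) ≡ π₁ ∘ (π₁ ∘ v)
    π₁∘u∘ v = ≡.trans (∘-extend v π₁∘⟨⟩) assoc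

    π₂∘u∘ : ∀ {X} (v : X ⇒ (A ⊗ V) ⊗ U) → π₂ ∘ (u ∘ v) ≡ π₂ ∘ v
    π₂∘u∘ v = ∘-extend v π₂∘⟨⟩

    γ∘u : ∀ {X} (v : X ⇒ (A ⊗ V) ⊗ U) → f ∘ (π₂ ∘ v) ≡ π₂ ∘ (π₁ ∘ v) → γ ∘ (u ∘ v) ≡ v
    γ∘u v on-graph = ⟨⟩-ext (⟨⟩-ext first second) third
      where
      open ≡.≡-Reasoning
      first : π₁ ∘ (π₁ ∘ (γ ∘ (u ∘ v))) ≡ π₁ ∘ (π₁ ∘ v)
      first = begin
        π₁ ∘ (π₁ ∘ (γ ∘ (u ∘ v)))   ≡⟨ cong (π₁ ∘_) (∘-extend (u ∘ v) π₁∘⟨⟩) ⟩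
        π₁ ∘ ((id ⊗₁ f) ∘ (u ∘ v))  ≡⟨ ∘-extend (u ∘ v) π₁∘id⊗₁ ⟩
        π₁ ∘ (u ∘ v)                ≡⟨ π₁∘u∘ v ⟩
        π₁ ∘ (π₁ ∘ v)               ∎
      second : π₂ ∘ (π₁ ∘ (γ ∘ (u ∘ v))) ≡ π₂ ∘ (π₁ ∘ v)
      second = begin
        π₂ ∘ (π₁ ∘ (γ ∘ (u ∘ v)))   ≡⟨ cong (π₂ ∘_) (∘-extend (u ∘ v) π₁∘⟨⟩) ⟩
        π₂ ∘ ((id ⊗₁ f) ∘ (u ∘ v))  ≡⟨ ∘-extend (u ∘ v) π₂∘⟨⟩ ⟩
        (f ∘ π₂) ∘ (u ∘ v)          ≡⟨ assoc ⟩
        f ∘ (π₂ ∘ (u ∘ v))          ≡⟨ cong (f ∘_) (π₂∘u∘ v) ⟩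
        f ∘ (π₂ ∘ v)                ≡⟨ on-graph ⟩
        π₂ ∘ (π₁ ∘ v)               ∎
      third : π₂ ∘ (γ ∘ (u ∘ v)) ≡ π₂ ∘ v
      third = ≡.trans (∘-extend (u ∘ v) π₂∘⟨⟩) (π₂∘u∘ v)

    π₁∘Δ∘ : ∀ {X} (a : X ⇒ V) → π₁ ∘ (Δ ∘ a) ≡ a
    π₁∘Δ∘ a = ≡.trans (∘-extend a π₁∘⟨⟩) identityˡ

    π₂∘Δ∘ : ∀ {X} (a : X ⇒ V) → π₂ ∘ (Δ ∘ a) ≡ a
    π₂∘Δ∘ a = ≡.trans (∘-extend a π₂∘⟨⟩) identityˡ

    π₁∘e∘ : ∀ {X} (v : X ⇒ (A ⊗ V) ⊗ U) → π₁ ∘ (e ∘ v) ≡ f ∘ (π₂ ∘ v)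
    π₁∘e∘ v = ≡.trans (∘-extend v π₁∘⟨⟩) assoc

    π₂∘e∘ : ∀ {X} (v : X ⇒ (A ⊗ V) ⊗ U) → π₂ ∘ (e ∘ v) ≡ π₂ ∘ (π₁ ∘ v)
    π₂∘e∘ v = ≡.trans (∘-extend v π₂∘⟨⟩) assoc

    graph-pullback : IsPullback (Δ {V}) e (f ∘ π₂) γ
    graph-pullback = commutes , universal
      where
      commutes : Δ ∘ (f ∘ π₂) ≡ e ∘ γ
      commutes = ⟨⟩-ext
        (≡.trans (π₁∘Δ∘ _) (≡.sym (≡.trans (π₁∘e∘ γ) (cong (f ∘_) π₂∘⟨⟩))))
        (≡.trans (π₂∘Δ∘ _) (≡.sym (≡.trans (π₂∘e∘ γ) (≡.trans (cong (π₂ ∘_) π₁∘⟨⟩) π₂∘⟨⟩))))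
      universal : ∀ {X} (a : X ⇒ V) (v : X ⇒ (A ⊗ V) ⊗ U) → Δ ∘ a ≡ e ∘ v →
        Σ (X ⇒ A ⊗ U) λ w → ((f ∘ π₂) ∘ w ≡ a) × (γ ∘ w ≡ v) ×
          (∀ w' → (f ∘ π₂) ∘ w' ≡ a → γ ∘ w' ≡ v → w' ≡ w)
      universal a v sq = u ∘ v , fπ₂ , γ∘u v (≡.trans (≡.sym a≡fπ₂v) a≡π₂π₁v) , unique
        where
        open ≡.≡-Reasoning
        a≡fπ₂v : a ≡ f ∘ (π₂ ∘ v)
        a≡fπ₂v = ≡.trans (≡.sym (π₁∘Δ∘ a)) (≡.trans (cong (π₁ ∘_) sq) (π₁∘e∘ v))
        a≡π₂π₁v : a ≡ π₂ ∘ (π₁ ∘ v)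
        a≡π₂π₁v = ≡.trans (≡.sym (π₂∘Δ∘ a)) (≡.trans (cong (π₂ ∘_) sq) (π₂∘e∘ v))
        fπ₂ : (f ∘ π₂) ∘ (u ∘ v) ≡ a
        fπ₂ = ≡.trans assoc (≡.trans (cong (f ∘_) (π₂∘u∘ v)) (≡.sym a≡fπ₂v))
        unique : ∀ w' → (f ∘ π₂) ∘ w' ≡ a → γ ∘ w' ≡ v → w' ≡ u ∘ v
        unique w' _ γw' = begin
          w'             ≡⟨ identityˡ ⟨
          id ∘ w'        ≡⟨ cong (_∘ w') u∘γ ⟨
          (u ∘ γ) ∘ w'   ≡⟨ assoc ⟩
          u ∘ (γ ∘ w')   ≡⟨ cong (u ∘_) γw' ⟩
          u ∘ v          ∎

    ∃-graph : ∀ φ → Eq ((A ⊗ V) ⊗ U) (∃f γ φ) (Meet _ (reindex e (δ V)) (reindex u φ))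
    ∃-graph φ = begin-equality
      ∃f γ φ                                             ≈⟨ ∃-cong γ φ-as-meet ⟩
      ∃f γ (Meet _ (Top _) (reindex γ (reindex u φ)))    ≈⟨ frobenius γ (Top _) (reindex u φ) ⟩
      Meet _ (∃f γ (Top _)) (reindex u φ)                ≈⟨ MeetLaws.∧-cong ∃γ⊤ Lat.Eq.refl ⟩
      Meet _ (reindex e (δ V)) (reindex u φ)             ∎
      where
      open Reasoning ((A ⊗ V) ⊗ U)
      φ-as-meet : Eq (A ⊗ U) φ (Meet _ (Top _) (reindex γ (reindex u φ)))
      φ-as-meet = Lat.Eq.sym (Lat.Eq.trans (TopLaws.identityˡ _) (reindex-retract γ u u∘γ φ))
      ∃γ⊤ : Eq _ (∃f γ (Top _)) (reindex e (δ V))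
      ∃γ⊤ = Lat.Eq.sym (Lat.Eq.trans (beck-chevalley graph-pullback (Top V))
                                     (∃-cong γ (reindex-⊤ (f ∘ π₂))))

    e∘m : e ∘ ((id ⊗₁ f) ⊗₁ id) ≡ (f ⊗₁ f) ∘ ⟨ π₂ , π₂ ∘ π₁ ⟩
    e∘m = begin
      e ∘ m                                ≡⟨ ⟨⟩∘ m ⟩
      ⟨ (f ∘ π₂) ∘ m , (π₂ ∘ π₁) ∘ m ⟩      ≡⟨ cong₂ ⟨_,_⟩ first second ⟩
      ⟨ f ∘ π₂ , f ∘ (π₂ ∘ π₁) ⟩            ≡⟨ ⊗₁∘⟨⟩ ⟨
      (f ⊗₁ f) ∘ ⟨ π₂ , π₂ ∘ π₁ ⟩           ∎
      where
      open ≡.≡-Reasoning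
      m = (id ⊗₁ f) ⊗₁ id
      first : (f ∘ π₂) ∘ m ≡ f ∘ π₂
      first = ≡.trans assoc (cong (f ∘_) π₂∘⊗₁id)
      second : (π₂ ∘ π₁) ∘ m ≡ f ∘ (π₂ ∘ π₁)
      second = ≡.trans assoc (≡.trans (cong (π₂ ∘_) π₁∘⟨⟩) (≡.trans (∘-extend π₁ π₂∘⟨⟩) assoc))

    u∘m : u ∘ ((id ⊗₁ f) ⊗₁ id) ≡ ⟨ π₁ ∘ π₁ , π₂ ⟩
    u∘m = ≡.trans (⟨⟩∘ _) (cong₂ ⟨_,_⟩ first π₂∘⊗₁id)
      where
      first : (π₁ ∘ π₁) ∘ ((id ⊗₁ f) ⊗₁ id) ≡ π₁ ∘ π₁
      first = ≡.trans assoc (≡.trans (cong (π₁ ∘_) π₁∘⟨⟩) (∘-extend π₁ π₁∘id⊗₁))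

  -- on W = (A ⊗ U) ⊗ U, with generalised element ((a,u),u'):
  -- the pair (u',u) and the pair (a,u')
  pr-u'u : ∀ {A U} → (A ⊗ U) ⊗ U ⇒ U ⊗ U
  pr-u'u = ⟨ π₂ , π₂ ∘ π₁ ⟩

  pr-au' : ∀ {A U} → (A ⊗ U) ⊗ U ⇒ A ⊗ U
  pr-au' = ⟨ π₁ ∘ π₁ , π₂ ⟩

  -- (id × f)* ∃_{id × f} φ (a,u)  =  ∃u'. δ_V(f u', f u) ∧ φ(a,u');
  -- it depends on f only through (f × f)* δ_V
  kernel-formula : ∀ {A U V} (f : U ⇒ V) (φ : Form (A ⊗ U)) →
    Eq (A ⊗ U) (reindex (id ⊗₁ f) (∃f (id ⊗₁ f) φ))
      (∃f π₁ (Meet _ (reindex pr-u'u (reindex (f ⊗₁ f) (δ V))) (reindex pr-au' φ)))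
  kernel-formula {A} {U} {V} f φ = begin-equality
    reindex (id ⊗₁ f) (∃f (id ⊗₁ f) φ)           ≈⟨ reindex-cong _ (∃-≡ φ π₁∘⟨⟩) ⟨
    reindex (id ⊗₁ f) (∃f (π₁ ∘ γ) φ)            ≈⟨ reindex-cong _ (∃-∘ γ π₁ φ) ⟩
    reindex (id ⊗₁ f) (∃f π₁ (∃f γ φ))           ≈⟨ reindex-cong _ (∃-cong π₁ (∃-graph φ)) ⟩
    reindex (id ⊗₁ f) (∃f π₁ Ψ)                  ≈⟨ beck-chevalley (product-pullbackˡ (id ⊗₁ f)) Ψ ⟩
    ∃f π₁ (reindex m Ψ)                          ≈⟨ ∃-cong π₁ (reindex-∧ m _ _) ⟩
    ∃f π₁ (Meet _ (reindex m (reindex e (δ V))) (reindex m (reindex u φ)))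
                                                 ≈⟨ ∃-cong π₁ (MeetLaws.∧-cong δ-part φ-part) ⟩
    ∃f π₁ (Meet _ (reindex pr-u'u (reindex (f ⊗₁ f) (δ V))) (reindex pr-au' φ)) ∎
    where
    open Reasoning (A ⊗ U)
    open Graph {A} f
    m : (A ⊗ U) ⊗ U ⇒ (A ⊗ V) ⊗ U
    m = (id ⊗₁ f) ⊗₁ id
    Ψ : Form ((A ⊗ V) ⊗ U)
    Ψ = Meet _ (reindex e (δ V)) (reindex u φ)
    δ-part : Eq _ (reindex m (reindex e (δ V))) (reindex pr-u'u (reindex (f ⊗₁ f) (δ V)))
    δ-part = Lat.Eq.trans (Lat.Eq.sym (reindex-∘ m e _))
               (Lat.Eq.trans (reindex-≡ _ e∘m) (reindex-∘ pr-u'u (f ⊗₁ f) _))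
    φ-part : Eq _ (reindex m (reindex u φ)) (reindex pr-au' φ)
    φ-part = Lat.Eq.trans (Lat.Eq.sym (reindex-∘ m u _)) (reindex-≡ _ u∘m)

  reindex-∃-injective : ∀ {A X Y} (d : X ⇒ Y) → InternallyInjective d →
    ∀ (G : Form (A ⊗ X)) → Eq (A ⊗ X) (reindex (id ⊗₁ d) (∃f (id ⊗₁ d) G)) G
  reindex-∃-injective {A} {X} {Y} d inj G = begin-equality
    reindex (id ⊗₁ d) (∃f (id ⊗₁ d) G)     ≈⟨ kernel-formula d G ⟩
    ∃f π₁ (Meet _ (reindex pr-u'u (reindex (d ⊗₁ d) (δ Y))) (reindex pr-au' G))
                                           ≈⟨ ∃-cong π₁ (MeetLaws.∧-cong (reindex-cong pr-u'u same-δ) Lat.Eq.refl) ⟩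
    ∃f π₁ (Meet _ (reindex pr-u'u (reindex (id ⊗₁ id) (δ X))) (reindex pr-au' G))
                                           ≈⟨ kernel-formula id G ⟨
    reindex (id ⊗₁ id) (∃f (id ⊗₁ id) G)   ≈⟨ reindex-≡ _ id⊗₁id ⟩
    reindex id (∃f (id ⊗₁ id) G)           ≈⟨ reindex-id _ ⟩
    ∃f (id ⊗₁ id) G                        ≈⟨ ∃-≡ G id⊗₁id ⟩
    ∃f id G                                ≈⟨ ∃-id G ⟩
    G                                      ∎
    where
    open Reasoning (A ⊗ X)
    same-δ : Eq (X ⊗ X) (reindex (d ⊗₁ d) (δ Y)) (reindex (id ⊗₁ id) (δ X))
    same-δ = Lat.Eq.trans (Lat.Eq.sym inj)
               (Lat.Eq.trans (Lat.Eq.sym (reindex-id _)) (reindex-≡ _ (≡.sym id⊗₁id)))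

  -- Power objects are sheaves

  module _ (PO : PowerObjects) where
    open PowerObjects PO

    members : ∀ {A Y} → Y ⇒ 𝒫 A → Form (A ⊗ Y)
    members {A} g = reindex (id ⊗₁ g) (∈ A)

    members-∘ : ∀ {A X Y} (g : Y ⇒ 𝒫 A) (d : X ⇒ Y) →
                Eq (A ⊗ X) (members (g ∘ d)) (reindex (id ⊗₁ d) (members g))
    members-∘ g d = Lat.Eq.trans (reindex-≡ _ (≡.sym id⊗₁∘id⊗₁)) (reindex-∘ (id ⊗₁ d) (id ⊗₁ g) _)

    members-injective : ∀ {A Y} {g g' : Y ⇒ 𝒫 A} → Eq (A ⊗ Y) (members g) (members g') → g ≡ g'
    members-injective {A} {Y} {g} {g'} e =
      ≡.trans (name-unique A Y (members g') g (Lat.Eq.sym e))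
              (≡.sym (name-unique A Y (members g') g' Lat.Eq.refl))

    powerObject-isSheaf : ∀ A → IsSheaf (𝒫 A)
    powerObject-isSheaf A {X} {Y} d n (inj , surj) = g , g∘d≡n , unique
      where
      F : Form (A ⊗ Y)
      F = ∃f (id ⊗₁ d) (members n)
      g : Y ⇒ 𝒫 A
      g = name A Y F
      g∘d≡n : g ∘ d ≡ n
      g∘d≡n = members-injective (begin-equality
        members (g ∘ d)                ≈⟨ members-∘ g d ⟩
        reindex (id ⊗₁ d) (members g)  ≈⟨ reindex-cong (id ⊗₁ d) (name-spec A Y F) ⟨
        reindex (id ⊗₁ d) F            ≈⟨ reindex-∃-injective d inj (members n) ⟩
        members n                      ∎)
        where open Reasoning (A ⊗ X)
      unique : ∀ g' → g' ∘ d ≡ n → g' ≡ g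
      unique g' g'∘d≡n = members-injective (begin-equality
        members g'                                ≈⟨ ∃-reindex-surjective (id ⊗₁ d) (id⊗₁-surjective d surj) _ ⟨
        ∃f (id ⊗₁ d) (reindex (id ⊗₁ d) (members g')) ≈⟨ ∃-cong (id ⊗₁ d) (members-∘ g' d) ⟨
        ∃f (id ⊗₁ d) (members (g' ∘ d))           ≡⟨ cong (λ z → ∃f (id ⊗₁ d) (members z)) g'∘d≡n ⟩
        F                                         ≈⟨ name-spec A Y F ⟩
        members g                                 ∎)
        where open Reasoning (A ⊗ Y)

  UniqueFactorisation : ∀ {X Y Z} → X ⇒ Z → Y ⇒ Z → Set h
  UniqueFactorisation {X} {Y} k f = Σ (Y ⇒ X) λ g → (k ∘ g ≡ f) × (∀ g' → k ∘ g' ≡ f → g' ≡ g)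

  UniqueExtension : ∀ {X Y A} → X ⇒ Y → X ⇒ A → Set h
  UniqueExtension {X} {Y} {A} d q = Σ (Y ⇒ A) λ g → (g ∘ d ≡ q) × (∀ g' → g' ∘ d ≡ q → g' ≡ g)

  module _ {B S : Obj} {α : Form B} {k : S ⇒ B} (comp : IsComprehension α k) where

    comprehension-holds : ∀ {Y} (g : Y ⇒ S) → Le Y (Top Y) (reindex (k ∘ g) α)
    comprehension-holds {Y} g = begin
      Top Y                       ≈⟨ reindex-⊤ g ⟨
      reindex g (Top S)           ≤⟨ reindex-mono g (proj₁ comp) ⟩
      reindex g (reindex k α)     ≈⟨ reindex-∘ g k α ⟨
      reindex (k ∘ g) α           ∎
      where open Reasoning Y

    comprehension-mono : ∀ {Y} {g g' : Y ⇒ S} → k ∘ g ≡ k ∘ g' → g ≡ g'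
    comprehension-mono {g = g} {g'} kg≡kg' =
      ≡.trans (unique g refl) (≡.sym (unique g' (≡.sym kg≡kg')))
      where
      factorisation : UniqueFactorisation k (k ∘ g)
      factorisation = proj₂ comp (k ∘ g) (comprehension-holds g)
      unique : ∀ g'' → k ∘ g'' ≡ k ∘ g → g'' ≡ proj₁ factorisation
      unique = proj₂ (proj₂ factorisation)

    comprehension-isSheaf : IsSheaf B → IsSheaf S
    comprehension-isSheaf B-sheaf {X} {Y} d q (inj , surj) = q̄ , q̄∘d≡q , unique
      where
      extension : UniqueExtension d (k ∘ q)
      extension = B-sheaf d (k ∘ q) (inj , surj)
      g : Y ⇒ B
      g = proj₁ extension
      g∘d≡kq : g ∘ d ≡ k ∘ q
      g∘d≡kq = proj₁ (proj₂ extension)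
      -- g satisfies α because g ∘ d does and d is internally surjective
      g∘d-satisfies : Le X (Top X) (reindex d (reindex g α))
      g∘d-satisfies = begin
        Top X                   ≤⟨ comprehension-holds q ⟩
        reindex (k ∘ q) α       ≡⟨ cong (λ z → reindex z α) g∘d≡kq ⟨
        reindex (g ∘ d) α       ≈⟨ reindex-∘ d g α ⟩
        reindex d (reindex g α) ∎
        where open Reasoning X
      g-satisfies : Le Y (Top Y) (reindex g α)
      g-satisfies = begin
        Top Y             ≈⟨ surj ⟨
        ∃f d (Top X)      ≤⟨ ∃-universal d g∘d-satisfies ⟩
        reindex g α       ∎
        where open Reasoning Y
      restriction : UniqueFactorisation k g
      restriction = proj₂ comp g g-satisfies
      q̄ : Y ⇒ S
      q̄ = proj₁ restriction
      k∘q̄≡g : k ∘ q̄ ≡ g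
      k∘q̄≡g = proj₁ (proj₂ restriction)
      q̄∘d≡q : q̄ ∘ d ≡ q
      q̄∘d≡q = comprehension-mono (≡.trans (≡.sym assoc) (≡.trans (cong (_∘ d) k∘q̄≡g) g∘d≡kq))
      unique : ∀ q̄' → q̄' ∘ d ≡ q → q̄' ≡ q̄
      unique q̄' q̄'∘d≡q = comprehension-mono
        (≡.trans (proj₂ (proj₂ extension) (k ∘ q̄') (≡.trans assoc (cong (k ∘_) q̄'∘d≡q)))
                 (≡.sym k∘q̄≡g))

  corestriction-surjective : ∀ {A B S} {f : A ⇒ B} {k : S ⇒ B} (e : A ⇒ S) →
    IsComprehension (∃f f (Top A)) k → k ∘ e ≡ f → InternallySurjective e
  corestriction-surjective {A} {B} {S} {f} {k} e comp k∘e≡f = Lat.antisym (Lat.maximum _) (begin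
    Top S                           ≤⟨ proj₁ comp ⟩
    reindex k (∃f f (Top A))        ≈⟨ reindex-cong k (∃-≡ (Top A) k∘e≡f) ⟨
    reindex k (∃f (k ∘ e) (Top A))  ≈⟨ reindex-cong k (∃-∘ e k (Top A)) ⟩
    reindex k (∃f k (∃f e (Top A))) ≈⟨ beck-chevalley (mono-kernel-pair k (comprehension-mono comp)) _ ⟩
    ∃f id (reindex id (∃f e (Top A))) ≈⟨ ∃-id _ ⟩
    reindex id (∃f e (Top A))       ≈⟨ reindex-id _ ⟩
    ∃f e (Top A)                    ∎)
    where open Reasoning S

  IsSheafReflection : ∀ {A S} → A ⇒ S → Set (o ⊔ h ⊔ ℓ₁)
  IsSheafReflection {A} η = ∀ (B : Obj) → IsSheaf B → ∀ (f : A ⇒ B) → UniqueExtension η f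

  bijection-isSheafReflection : ∀ {A S} (η : A ⇒ S) → InternallyBijective η → IsSheafReflection η
  bijection-isSheafReflection η η-bijective B B-sheaf f = B-sheaf η f η-bijective

proposition4p6 : ∀ {o h c ℓ₁ ℓ₂} (C : Category o h) (FP : FiniteProducts C)
    (D : Doctrine C FP c ℓ₁ ℓ₂) (E : ElementaryExistential D) →
    Notions.HasSingletons E → Notions.AdmitsSheafification E
proposition4p6 C FP D E H A =
  S , comprehension-isSheaf k-comp (powerObject-isSheaf power A) ,
  η , bijection-isSheafReflection η (η-injective , η-surjective)
  where
  open Category C
  open Doctrine D
  open ElementaryExistential E
  open Notions E
  open Notions.HasSingletons H
  open PowerObjects power
  open Sheafification E
  image : HasImage (sgl A)
  image = sgl-image A
  S : Obj
  S = proj₁ image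
  k : S ⇒ 𝒫 A
  k = proj₁ (proj₂ image)
  k-comp : IsComprehension (∃f (sgl A) (Top A)) k
  k-comp = proj₂ (proj₂ image)
  corestriction : UniqueFactorisation k (sgl A)
  corestriction = proj₂ k-comp (sgl A) (∃-unit (sgl A) (Top A))
  η : A ⇒ S
  η = proj₁ corestriction
  k∘η≡sgl : k ∘ η ≡ sgl A
  k∘η≡sgl = proj₁ (proj₂ corestriction)
  η-injective : InternallyInjective η
  η-injective = injective-cancel η k (≡.subst InternallyInjective (≡.sym k∘η≡sgl) (sgl-injective A))
  η-surjective : InternallySurjective η
  η-surjective = corestriction-surjective η k-comp k∘η≡sgl
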